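{- Let $c\ge0$ be a fixed integer and let $\widetilde{K}_{c,n}$ be the graph obtained from the complete bipartite graph $K_{c,n}$ by adding, for each vertex $v$, a new vertex $v'$ adjacent only to $v$. Then $\lim_{n\to\infty}\mathcal{I}(\widetilde{K}_{c,n})=1$.
   Context: For a finite simple graph $G$: a matching is a set of pairwise vertex-disjoint edges; it is maximal if not contained in a larger matching. $\nu(G)$ is the maximum matching size, $\mathcal{T}_0(G)$ the number of maximal matchings, $\mathcal{T}_1(G)$ the sum of the sizes of all maximal matchings, and $\mathcal{I}(G)=\frac{\mathcal{T}_1(G)}{\nu(G)\mathcal{T}_0(G)}$ (equal to $1$ by convention if $\nu(G)=0$). -}

module Defs where

open import Data.Bool using (Bool; true; false; _∧_; _∨_; not; _xor_; if_then_else_)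
open import Data.Nat using (ℕ; zero; suc; _+_; _*_; _<ᵇ_; _⊔_)
open import Data.Fin using (Fin; toℕ; splitAt)
open import Data.Fin.Properties using (_≟_)
open import Data.Product using (_×_; _,_)
open import Data.Sum using (inj₁; inj₂)
open import Data.List using (List; []; _∷_; map; _++_; filter; length; foldr; concatMap; allFin)
open import Data.Bool.ListAction using (any; all)
open import Data.Nat.ListAction using (sum)
open import Data.Integer using (+_)
open import Data.Rational using (ℚ; _/_; 1ℚ)
open import Relation.Nullary.Decidable using (⌊_⌋)

-- A finite simple graph on vertex set Fin V, given by a Boolean adjacency
-- relation (for the graphs used below it is symmetric and irreflexive by construction).
record Graph : Set where
  field
    V   : ℕ
    adj : Fin V → Fin V → Bool
open Graph public

Edge : Graph → Set
Edge G = Fin (V G) × Fin (V G)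

edges : (G : Graph) → List (Edge G)
edges G = concatMap (λ i → concatMap (λ j →
            if (toℕ i <ᵇ toℕ j) ∧ adj G i j then (i , j) ∷ [] else []) (allFin (V G)))
          (allFin (V G))

sublists : {A : Set} → List A → List (List A)
sublists []       = [] ∷ []
sublists (x ∷ xs) = map (x ∷_) (sublists xs) ++ sublists xs

edgeSets : (G : Graph) → List (List (Edge G))
edgeSets G = sublists (edges G)

module _ {n : ℕ} where
  elemᵇ : Fin n → List (Fin n) → Bool
  elemᵇ x = any (λ y → ⌊ x ≟ y ⌋)

  noDupᵇ : List (Fin n) → Bool
  noDupᵇ []       = true
  noDupᵇ (x ∷ xs) = not (elemᵇ x xs) ∧ noDupᵇ xs

  eqEdgeᵇ : Fin n × Fin n → Fin n × Fin n → Bool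
  eqEdgeᵇ (a , b) (c , d) = ⌊ a ≟ c ⌋ ∧ ⌊ b ≟ d ⌋

  endpoints : List (Fin n × Fin n) → List (Fin n)
  endpoints = concatMap (λ { (a , b) → a ∷ b ∷ [] })

  -- pairwise vertex-disjoint edges <=> the list of endpoints has no repetition
  isMatchingᵇ : List (Fin n × Fin n) → Bool
  isMatchingᵇ M = noDupᵇ (endpoints M)

  subsetᵇ : List (Fin n × Fin n) → List (Fin n × Fin n) → Bool
  subsetᵇ M M' = all (λ e → any (eqEdgeᵇ e) M') M

isMaximalᵇ : (G : Graph) → List (Edge G) → Bool
isMaximalᵇ G M = isMatchingᵇ M ∧
  not (any (λ M' → isMatchingᵇ M' ∧ subsetᵇ M M' ∧ (length M <ᵇ length M')) (edgeSets G))

matchings : (G : Graph) → List (List (Edge G))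
matchings G = filter (λ M → isMatchingᵇ M Data.Bool.≟ true) (edgeSets G)

maximalMatchings : (G : Graph) → List (List (Edge G))
maximalMatchings G = filter (λ M → isMaximalᵇ G M Data.Bool.≟ true) (edgeSets G)

ν : Graph → ℕ
ν G = foldr _⊔_ 0 (map length (matchings G))

T₀ : Graph → ℕ
T₀ G = length (maximalMatchings G)

T₁ : Graph → ℕ
T₁ G = sum (map length (maximalMatchings G))

-- I(G) = T₁ / (ν T₀), and 1 if ν(G) = 0.
-- (If ν(G) ≥ 1 then T₀(G) ≥ 1, so ν T₀ = 0 iff ν = 0.)
ratio : ℕ → ℕ → ℚ
ratio a zero    = 1ℚ
ratio a (suc d) = (+ a) / suc d

𝓘 : Graph → ℚ
𝓘 G = ratio (T₁ G) (ν G * T₀ G)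

-- K̃_{c,n}: vertices Fin ((c+n) + (c+n)); the first c+n are the vertices of K_{c,n}
-- (indices < c form one side, the remaining n the other side); the vertex (c+n)+a
-- is the pendant vertex a' attached only to a.
Ktilde : ℕ → ℕ → Graph
Ktilde c n = record { V = (c + n) + (c + n) ; adj = a }
  where
    m = c + n
    a : Fin (m + m) → Fin (m + m) → Bool
    a u w with splitAt m u | splitAt m w
    ... | inj₁ x | inj₁ y = (toℕ x <ᵇ c) xor (toℕ y <ᵇ c)
    ... | inj₁ x | inj₂ y = ⌊ x ≟ y ⌋
    ... | inj₂ x | inj₁ y = ⌊ x ≟ y ⌋
    ... | inj₂ x | inj₂ y = false

-- In a maximal matching of K̃_{c,n} each of the n vertices b on the second side of K_{c,n}
-- is matched, for otherwise the edge from b to its pendant vertex could be added.  These n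
-- vertices are pairwise non-adjacent, so every maximal matching has at least n edges, while
-- no matching has more than c + n.  Hence n T₀ ≤ T₁ ≤ ν T₀ ≤ (c + n) T₀, so that
-- 1 - 𝓘 ≤ c / (c + n), which tends to 0.
module Submission where

open import Defs

open import Data.Bool using (Bool; true; false; T; not; if_then_else_)
open import Data.Bool.Properties using (T-∧; T-≡)
open import Data.Empty using (⊥)
open import Data.Fin as Fin using (Fin; toℕ; splitAt; _↑ˡ_; _↑ʳ_)
open import Data.Fin.Properties
  using (_≟_; injective⇒≤; toℕ<n; toℕ-↑ˡ; toℕ-↑ʳ; ↑ˡ-injective; ↑ʳ-injective; splitAt-↑ˡ; splitAt-↑ʳ; splitAt⁻¹-↑ˡ)
open import Data.Integer as ℤ using (+_; -[1+_]; +[1+_])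
import Data.Integer.Properties as ℤ
open import Data.List using (List; []; _∷_; map; length; lookup; allFin)
open import Data.List.Properties using (foldr-preservesᵒ; foldr-preservesᵇ)
open import Data.List.Membership.Propositional using (_∈_; _∉_; find; lose)
open import Data.List.Membership.Propositional.Properties
  using (∈-lookup; ∈-filter⁺; ∈-filter⁻; ∈-concatMap⁺; ∈-concatMap⁻; ∈-allFin; ∈-++⁺ˡ; ∈-++⁺ʳ; ∈-++⁻; ∈-map⁺; ∈-map⁻)
open import Data.List.Relation.Binary.Subset.Propositional using (_⊆_)
open import Data.List.Relation.Binary.Sublist.Propositional as Sublist using ([]; _∷_; _∷ʳ_) renaming (_⊆_ to _⊑_)
open import Data.List.Relation.Binary.Permutation.Propositional as ↭
  using (_↭_; ↭-sym; ↭⇒↭ₛ; ↭-refl; ↭-prep; ↭-swap; ↭-trans)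
open import Data.List.Relation.Binary.Permutation.Propositional.Properties using (shifts; ∈-resp-↭; ↭-length)
import Data.List.Relation.Binary.Permutation.Setoid.Properties as ↭ₛ
open import Data.List.Relation.Unary.All as All using (All; []; _∷_)
open import Data.List.Relation.Unary.All.Properties using (all⁻; ¬Any⇒All¬; All¬⇒¬Any)
import Data.List.Relation.Unary.All.Properties as All
open import Data.List.Relation.Unary.Any as Any using (Any; here; there; any?)
open import Data.List.Relation.Unary.Any.Properties using (any⁺; any⁻; lookup-index)
import Data.List.Relation.Unary.Any.Properties as Any
open import Data.List.Relation.Unary.AllPairs using ([]; _∷_)
open import Data.List.Relation.Unary.Unique.Propositional using (Unique)
open import Data.Nat as ℕ using (ℕ; zero; suc; _+_; _*_; _∸_; _≤_; _<ᵇ_; _⊔_; z≤n; NonZero)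
open import Data.Nat.ListAction using (sum)
open import Data.Nat.Properties
  using (+-suc; +-comm; *-comm; *-assoc; *-identityʳ; *-distribˡ-+; _≤?_; ≤-refl; ≤-reflexive; ≤-trans; <-≤-trans;
         <-irrefl; ≰⇒>; <⇒≱; <ᵇ⇒<; <⇒<ᵇ; +-mono-≤; +-monoʳ-≤; +-mono-<; *-monoˡ-≤; *-monoʳ-≤; *-monoʳ-<;
         m≤m+n; m+n≮m; m≤n*m; m*n≢0⇒n≢0; m≤n+o⇒m∸n≤o; ⊔-lub; m≤m⊔n; m≤n⊔m; module ≤-Reasoning)
open import Data.Product using (_×_; _,_; ∃-syntax; proj₁; proj₂)
open import Data.Rational using (ℚ; mkℚ; 0ℚ; 1ℚ; -_; _<_; _-_; ∣_∣; ↧ₙ_; toℚᵘ; *<*)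
open import Data.Rational.Properties using (toℚᵘ-cancel-<; toℚᵘ-homo-∣-∣; toℚᵘ-homo-+; toℚᵘ-fromℚᵘ)
open import Data.Rational.Unnormalised as ℚᵘ using (mkℚᵘ; _≃_)
import Data.Rational.Unnormalised.Properties as ℚᵘ
open import Data.Sum using (_⊎_; inj₁; inj₂; [_,_]′)
open import Function using (_∘_; Equivalence)
open import Relation.Nullary using (¬_; contradiction; yes; no)
open import Relation.Nullary.Decidable using (toWitness; fromWitness)
open import Relation.Binary.PropositionalEquality
  using (_≡_; _≢_; refl; cong; cong₂; sym; trans; subst; subst₂)
import Relation.Binary.PropositionalEquality as ≡

private variable
  A : Set
  k : ℕ

Unique-resp-↭ : {xs ys : List A} → xs ↭ ys → Unique xs → Unique ys
Unique-resp-↭ {A = A} π = ↭ₛ.Unique-resp-↭ (≡.setoid A) (↭⇒↭ₛ π)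

Unique⇒lookup-injective : {xs : List A} → Unique xs → ∀ {i j} → lookup xs i ≡ lookup xs j → i ≡ j
Unique⇒lookup-injective (_ ∷ _)   {Fin.zero}  {Fin.zero}  _   = refl
Unique⇒lookup-injective (x≢ ∷ _)  {Fin.zero}  {Fin.suc j} x≡  = contradiction x≡ (All.lookup x≢ (∈-lookup j))
Unique⇒lookup-injective (x≢ ∷ _)  {Fin.suc i} {Fin.zero}  ≡x  = contradiction (sym ≡x) (All.lookup x≢ (∈-lookup i))
Unique⇒lookup-injective (_ ∷ u)   {Fin.suc i} {Fin.suc j} eq  = cong Fin.suc (Unique⇒lookup-injective u eq)

Unique⇒length≤ : {xs : List (Fin k)} → Unique xs → length xs ≤ k
Unique⇒length≤ u = injective⇒≤ (Unique⇒lookup-injective u)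

sublists⁺ : {M es : List A} → M ⊑ es → M ∈ sublists es
sublists⁺ []                   = here refl
sublists⁺ (_∷ʳ_ {ys = es} e τ) = ∈-++⁺ʳ (map (e ∷_) (sublists es)) (sublists⁺ τ)
sublists⁺ (refl ∷ τ)           = ∈-++⁺ˡ (∈-map⁺ _ (sublists⁺ τ))

sublists⁻ : {M : List A} (es : List A) → M ∈ sublists es → M ⊑ es
sublists⁻ []       (here refl) = []
sublists⁻ (e ∷ es) M∈ with ∈-++⁻ (map (e ∷_) (sublists es)) M∈
... | inj₁ M∈e∷ with M₀ , M₀∈ , refl ← ∈-map⁻ _ M∈e∷ = refl ∷ sublists⁻ es M₀∈
... | inj₂ M∈′  = e ∷ʳ sublists⁻ es M∈′

⊑-insert : {M es : List A} {e : A} → M ⊑ es → e ∈ es → e ∉ M → ∃[ M' ] (M' ⊑ es × M' ↭ e ∷ M)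
⊑-insert (_∷ʳ_ {xs = M} y τ) (here refl) _ = y ∷ M , refl ∷ τ , ↭-refl
⊑-insert (y ∷ʳ τ) (there e∈) e∉ with M' , τ' , π ← ⊑-insert τ e∈ e∉ = M' , y ∷ʳ τ' , π
⊑-insert (refl ∷ τ) (here refl) e∉ = contradiction (here refl) e∉
⊑-insert (_∷_ {x = x} refl τ) (there e∈) e∉ with M' , τ' , π ← ⊑-insert τ e∈ (e∉ ∘ there) =
  x ∷ M' , refl ∷ τ' , ↭-trans (↭-prep x π) (↭-swap x _ ↭-refl)

∈-if⁺ : {b : Bool} {x : A} → T b → x ∈ (if b then x ∷ [] else [])
∈-if⁺ {b = true} _ = here refl

∈-if⁻ : (b : Bool) {x y : A} → x ∈ (if b then y ∷ [] else []) → T b × x ≡ y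
∈-if⁻ true (here x≡y) = _ , x≡y

module _ (f : A → ℕ) (a : ℕ) where

  sum-map-≤ : {xs : List A} → All (λ x → f x ≤ a) xs → sum (map f xs) ≤ length xs * a
  sum-map-≤ []           = z≤n
  sum-map-≤ (fx≤ ∷ fxs≤) = +-mono-≤ fx≤ (sum-map-≤ fxs≤)

  ≤-sum-map : {xs : List A} → All (λ x → a ≤ f x) xs → length xs * a ≤ sum (map f xs)
  ≤-sum-map []           = z≤n
  ≤-sum-map (≤fx ∷ ≤fxs) = +-mono-≤ ≤fx (≤-sum-map ≤fxs)

T-not⁺ : {b : Bool} → ¬ T b → T (not b)
T-not⁺ {true}  ¬t = ¬t _
T-not⁺ {false} _  = _

T-not⁻ : {b : Bool} → T (not b) → ¬ T b
T-not⁻ {true} ()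

module _ {x : Fin k} where

  elemᵇ⁺ : {xs : List (Fin k)} → x ∈ xs → T (elemᵇ x xs)
  elemᵇ⁺ = any⁺ _ ∘ Any.map (λ { refl → fromWitness refl })

  elemᵇ⁻ : (xs : List (Fin k)) → T (elemᵇ x xs) → x ∈ xs
  elemᵇ⁻ xs = Any.map toWitness ∘ any⁻ _ xs

noDupᵇ⁺ : {xs : List (Fin k)} → Unique xs → T (noDupᵇ xs)
noDupᵇ⁺ []                     = _
noDupᵇ⁺ {xs = x ∷ xs} (x∉ ∷ u) =
  Equivalence.from T-∧ (T-not⁺ (All¬⇒¬Any x∉ ∘ elemᵇ⁻ xs) , noDupᵇ⁺ u)

noDupᵇ⁻ : (xs : List (Fin k)) → T (noDupᵇ xs) → Unique xs
noDupᵇ⁻ []       _ = []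
noDupᵇ⁻ (x ∷ xs) t with x∉ , u ← Equivalence.to T-∧ t =
  ¬Any⇒All¬ xs (T-not⁻ x∉ ∘ elemᵇ⁺) ∷ noDupᵇ⁻ xs u

eqEdgeᵇ-refl : (e : Fin k × Fin k) → T (eqEdgeᵇ e e)
eqEdgeᵇ-refl (a , b) = Equivalence.from T-∧ (fromWitness {a? = a ≟ a} refl , fromWitness {a? = b ≟ b} refl)

subsetᵇ⁺ : {M M' : List (Fin k × Fin k)} → M ⊆ M' → T (subsetᵇ M M')
subsetᵇ⁺ M⊆M' = all⁻ _ (All.tabulate λ {e} e∈M →
  any⁺ _ (Any.map (λ { refl → eqEdgeᵇ-refl e }) (M⊆M' e∈M)))

module _ (G : Graph) {u v : Fin (V G)} where

  ∈-edges⁺ : toℕ u ℕ.< toℕ v → T (adj G u v) → (u , v) ∈ edges G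
  ∈-edges⁺ u<v uv = ∈-concatMap⁺ _ (lose (∈-allFin u) (∈-concatMap⁺ _ (lose (∈-allFin v)
    (∈-if⁺ (Equivalence.from T-∧ (<⇒<ᵇ u<v , uv))))))

  ∈-edges⁻ : (u , v) ∈ edges G → toℕ u ℕ.< toℕ v × T (adj G u v)
  ∈-edges⁻ uv∈
    with i , _ , uv∈ᵢ  ← find (∈-concatMap⁻ _ {xs = allFin (V G)} uv∈)
    with j , _ , uv∈ᵢⱼ ← find (∈-concatMap⁻ _ {xs = allFin (V G)} uv∈ᵢ)
    with t , refl      ← ∈-if⁻ _ uv∈ᵢⱼ
    with u<ᵇv , uv     ← Equivalence.to T-∧ t
    = <ᵇ⇒< _ _ u<ᵇv , uv

-- Matchings

infix 4 _∈ₑ_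
_∈ₑ_ : Fin k → Fin k × Fin k → Set
x ∈ₑ (u , v) = x ≡ u ⊎ x ≡ v

∈-endpoints⁺ : {x : Fin k} {M : List (Fin k × Fin k)} → Any (x ∈ₑ_) M → x ∈ endpoints M
∈-endpoints⁺ (here (inj₁ x≡u)) = here x≡u
∈-endpoints⁺ (here (inj₂ x≡v)) = there (here x≡v)
∈-endpoints⁺ (there x∈ₑM)      = there (there (∈-endpoints⁺ x∈ₑM))

∈-endpoints⁻ : {x : Fin k} (M : List (Fin k × Fin k)) → x ∈ endpoints M → Any (x ∈ₑ_) M
∈-endpoints⁻ (_ ∷ M) (here x≡u)         = here (inj₁ x≡u)
∈-endpoints⁻ (_ ∷ M) (there (here x≡v)) = here (inj₂ x≡v)
∈-endpoints⁻ (_ ∷ M) (there (there x∈)) = there (∈-endpoints⁻ M x∈)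

length-endpoints : (M : List (Fin k × Fin k)) → length (endpoints M) ≡ length M + length M
length-endpoints []      = refl
length-endpoints (_ ∷ M) = cong suc (trans (cong suc (length-endpoints M)) (sym (+-suc (length M) (length M))))

endpoints-↭ : {M M' : List (Fin k × Fin k)} → M ↭ M' → endpoints M ↭ endpoints M'
endpoints-↭ ↭.refl                     = ↭-refl
endpoints-↭ (↭.prep (a , b) π)         = ↭-prep a (↭-prep b (endpoints-↭ π))
endpoints-↭ (↭.swap (a , b) (c , d) π) =
  ↭-trans (shifts (a ∷ b ∷ []) (c ∷ d ∷ [])) (↭-prep c (↭-prep d (↭-prep a (↭-prep b (endpoints-↭ π)))))
endpoints-↭ (↭.trans π π')             = ↭-trans (endpoints-↭ π) (endpoints-↭ π')

IsMatching : List (Fin k × Fin k) → Set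
IsMatching M = Unique (endpoints M)

x+x≤y+y⇒x≤y : ∀ {x y} → x + x ≤ y + y → x ≤ y
x+x≤y+y⇒x≤y {x} {y} x+x≤y+y with x ≤? y
... | yes x≤y = x≤y
... | no  x≰y = contradiction x+x≤y+y (<⇒≱ (+-mono-< (≰⇒> x≰y) (≰⇒> x≰y)))

matching⇒length≤ : {m : ℕ} {M : List (Fin (m + m) × Fin (m + m))} → IsMatching M → length M ≤ m
matching⇒length≤ {M = M} M-matching =
  x+x≤y+y⇒x≤y (subst (_≤ _) (length-endpoints M) (Unique⇒length≤ M-matching))

distinctly-covered⇒≤length : {n : ℕ} {M : List (Fin k × Fin k)} (w : Fin n → Fin k) →
  (∀ j → w j ∈ endpoints M) → (∀ {i j e} → e ∈ M → w i ∈ₑ e → w j ∈ₑ e → i ≡ j) → n ≤ length M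
distinctly-covered⇒≤length {M = M} w covered distinct = injective⇒≤ λ {i} {j} same-edge →
  distinct (∈-lookup _) (lookup-index (cover i))
    (subst (λ p → w j ∈ₑ lookup M p) (sym same-edge) (lookup-index (cover j)))
  where
  cover : ∀ j → Any (w j ∈ₑ_) M
  cover j = ∈-endpoints⁻ M (covered j)

module _ {G : Graph} {M : List (Edge G)} (M-max : T (isMaximalᵇ G M)) where

  maximal⇒matching : IsMatching M
  maximal⇒matching = noDupᵇ⁻ _ (proj₁ (Equivalence.to T-∧ M-max))

  maximal⇒unextendable : ∀ {M'} → M' ∈ edgeSets G → IsMatching M' → M ⊆ M' → length M ℕ.< length M' → ⊥
  maximal⇒unextendable M'∈ M'-matching M⊆M' M<M' =
    T-not⁻ (proj₂ (Equivalence.to T-∧ M-max)) (any⁺ _ (lose M'∈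
      (Equivalence.from T-∧ (noDupᵇ⁺ M'-matching , Equivalence.from T-∧ (subsetᵇ⁺ M⊆M' , <⇒<ᵇ M<M')))))

-- otherwise the edge bb' could be added to M
maximal-covers-pendant-neighbour : (G : Graph) {M : List (Edge G)} {b b' : Fin (V G)} →
  M ∈ edgeSets G → T (isMaximalᵇ G M) → (b , b') ∈ edges G →
  (∀ {e} → e ∈ edges G → b' ∈ₑ e → b ∈ₑ e) → b ∈ endpoints M
maximal-covers-pendant-neighbour G {M} {b} {b'} M∈ M-max bb'∈ pendant
  with any? (b ≟_) (endpoints M)
... | yes b∈ = b∈
... | no  b∉
  with M' , M'⊑ , π ← ⊑-insert (sublists⁻ (edges G) M∈) bb'∈ (b∉ ∘ ∈-endpoints⁺ ∘ Any.map λ { refl → inj₁ refl })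
  = contradiction M<M' (maximal⇒unextendable M-max (sublists⁺ M'⊑) M'-matching M⊆M')
  where
  b'∉ : b' ∉ endpoints M
  b'∉ b'∈ with e , e∈M , b'∈ₑe ← find (∈-endpoints⁻ M b'∈) =
    b∉ (∈-endpoints⁺ (lose e∈M (pendant (Sublist.lookup (sublists⁻ (edges G) M∈) e∈M) b'∈ₑe)))

  b≢b' : b ≢ b'
  b≢b' refl = <-irrefl refl (proj₁ (∈-edges⁻ G bb'∈))

  M'-matching : IsMatching M'
  M'-matching = Unique-resp-↭ (↭-sym (endpoints-↭ π))
    (¬Any⇒All¬ _ (λ { (here b≡b') → b≢b' b≡b' ; (there b∈) → b∉ b∈ })
      ∷ ¬Any⇒All¬ _ b'∉ ∷ maximal⇒matching {M = M} M-max)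

  M⊆M' : M ⊆ M'
  M⊆M' = ∈-resp-↭ (↭-sym π) ∘ there

  M<M' : length M ℕ.< length M'
  M<M' = ≤-reflexive (sym (↭-length π))

module _ (G : Graph) where

  ∈-maximalMatchings⁻ : {M : List (Edge G)} → M ∈ maximalMatchings G → M ∈ edgeSets G × T (isMaximalᵇ G M)
  ∈-maximalMatchings⁻ M∈ with M∈edgeSets , M-max ← ∈-filter⁻ _ {xs = edgeSets G} M∈ =
    M∈edgeSets , Equivalence.from T-≡ M-max

  ∈-matchings⁻ : {M : List (Edge G)} → M ∈ matchings G → IsMatching M
  ∈-matchings⁻ M∈ = noDupᵇ⁻ _ (Equivalence.from T-≡ (proj₂ (∈-filter⁻ _ {xs = edgeSets G} M∈)))

  length≤ν : {M : List (Edge G)} → M ∈ matchings G → length M ≤ ν G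
  length≤ν {M} M∈ = foldr-preservesᵒ {P = length M ≤_} {f = _⊔_}
    (λ x y → [ (λ ≤x → ≤-trans ≤x (m≤m⊔n x y)) , (λ ≤y → ≤-trans ≤y (m≤n⊔m x y)) ]′)
    0 (map length (matchings G)) (inj₂ (Any.map⁺ (lose M∈ ≤-refl)))

  ν≤ : ∀ {k} → (∀ {M} → M ∈ matchings G → length M ≤ k) → ν G ≤ k
  ν≤ {k} bound = foldr-preservesᵇ {P = _≤ k} ⊔-lub z≤n (All.map⁺ (All.tabulate bound))

  T₁≤ν*T₀ : T₁ G ≤ ν G * T₀ G
  T₁≤ν*T₀ = ≤-trans (sum-map-≤ length (ν G) (All.tabulate maximal⇒length≤ν)) (≤-reflexive (*-comm (T₀ G) (ν G)))
    where
    maximal⇒length≤ν : ∀ {M} → M ∈ maximalMatchings G → length M ≤ ν G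
    maximal⇒length≤ν {M} M∈ with M∈edgeSets , M-max ← ∈-maximalMatchings⁻ M∈ =
      length≤ν (∈-filter⁺ _ M∈edgeSets (Equivalence.to T-≡ (noDupᵇ⁺ (maximal⇒matching {M = M} M-max))))

-- The graph K̃_{c,n}

module _ (c n : ℕ) where

  private
    m = c + n
    G = Ktilde c n

  neighbour-of-pendantˡ : (x : Fin m) (w : Fin (m + m)) → T (adj G (m ↑ʳ x) w) → w ≡ x ↑ˡ m
  neighbour-of-pendantˡ x w rewrite splitAt-↑ʳ m m x with splitAt m w in eq
  ... | inj₁ y = λ x≟y → trans (sym (splitAt⁻¹-↑ˡ eq)) (cong (_↑ˡ m) (sym (toWitness x≟y)))
  ... | inj₂ y = λ ()

  neighbour-of-pendantʳ : (x : Fin m) (w : Fin (m + m)) → T (adj G w (m ↑ʳ x)) → w ≡ x ↑ˡ m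
  neighbour-of-pendantʳ x w rewrite splitAt-↑ʳ m m x with splitAt m w in eq
  ... | inj₁ y = λ y≟x → trans (sym (splitAt⁻¹-↑ˡ eq)) (cong (_↑ˡ m) (toWitness y≟x))
  ... | inj₂ y = λ ()

  pendant-edge : (x : Fin m) → (x ↑ˡ m , m ↑ʳ x) ∈ edges G
  pendant-edge x = ∈-edges⁺ G increasing adjacent
    where
    increasing : toℕ (x ↑ˡ m) ℕ.< toℕ (m ↑ʳ x)
    increasing rewrite toℕ-↑ˡ x m | toℕ-↑ʳ m x = ≤-trans (toℕ<n x) (m≤m+n m _)
    adjacent : T (adj G (x ↑ˡ m) (m ↑ʳ x))
    adjacent rewrite splitAt-↑ˡ m x m | splitAt-↑ʳ m m x = fromWitness {a? = x ≟ x} refl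

  pendant-only-neighbour : (x : Fin m) {e : Edge G} → e ∈ edges G → m ↑ʳ x ∈ₑ e → x ↑ˡ m ∈ₑ e
  pendant-only-neighbour x {u , v} e∈ (inj₁ refl) = inj₂ (sym (neighbour-of-pendantˡ x v (proj₂ (∈-edges⁻ G e∈))))
  pendant-only-neighbour x {u , v} e∈ (inj₂ refl) = inj₁ (sym (neighbour-of-pendantʳ x u (proj₂ (∈-edges⁻ G e∈))))

  b : Fin n → Fin (m + m)
  b j = (c ↑ʳ j) ↑ˡ m

  b-injective : ∀ {i j} → b i ≡ b j → i ≡ j
  b-injective = ↑ʳ-injective c _ _ ∘ ↑ˡ-injective m _ _

  c+k<ᵇc≡false : ∀ k → (c + k <ᵇ c) ≡ false
  c+k<ᵇc≡false k with c + k <ᵇ c in eq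
  ... | false = refl
  ... | true  = contradiction (<ᵇ⇒< _ _ (Equivalence.from T-≡ eq)) (m+n≮m c k)

  b-independent : (i j : Fin n) → ¬ T (adj G (b i) (b j))
  b-independent i j
    rewrite splitAt-↑ˡ m (c ↑ʳ i) m | splitAt-↑ˡ m (c ↑ʳ j) m
          | toℕ-↑ʳ c i | toℕ-↑ʳ c j | c+k<ᵇc≡false (toℕ i) | c+k<ᵇc≡false (toℕ j) = λ ()

  b-distinct : ∀ {i j} {e : Edge G} → e ∈ edges G → b i ∈ₑ e → b j ∈ₑ e → i ≡ j
  b-distinct         _  (inj₁ refl) (inj₁ bj≡) = b-injective (sym bj≡)
  b-distinct {i} {j} e∈ (inj₁ refl) (inj₂ refl) = contradiction (proj₂ (∈-edges⁻ G e∈)) (b-independent i j)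
  b-distinct {i} {j} e∈ (inj₂ refl) (inj₁ refl) = contradiction (proj₂ (∈-edges⁻ G e∈)) (b-independent j i)
  b-distinct         _  (inj₂ refl) (inj₂ bj≡) = b-injective (sym bj≡)

  maximal⇒n≤length : ∀ {M} → M ∈ maximalMatchings G → n ≤ length M
  maximal⇒n≤length {M} M∈ with M∈edgeSets , M-max ← ∈-maximalMatchings⁻ G M∈ =
    distinctly-covered⇒≤length b
      (λ j → maximal-covers-pendant-neighbour G M∈edgeSets M-max (pendant-edge (c ↑ʳ j)) (pendant-only-neighbour (c ↑ʳ j)))
      (b-distinct ∘ Sublist.lookup (sublists⁻ (edges G) M∈edgeSets))

  T₀*n≤T₁ : T₀ G * n ≤ T₁ G
  T₀*n≤T₁ = ≤-sum-map length n (All.tabulate maximal⇒n≤length)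

  ν≤c+n : ν G ≤ c + n
  ν≤c+n = ν≤ G λ {M} M∈ → matching⇒length≤ {M = M} (∈-matchings⁻ G M∈)

-- Estimating 𝓘

deficit-bound : ∀ {n c q t s ν} → t * n ≤ s → s ≤ ν * t → ν ≤ c + n → c * q ℕ.< n →
                .{{NonZero (ν * t)}} → (ν * t ∸ s) * q ℕ.< ν * t
deficit-bound {n} {c} {q} {t} {s} {ν} tn≤s s≤νt ν≤c+n cq<n = begin-strict
  (ν * t ∸ s) * q ≤⟨ *-monoˡ-≤ q deficit≤tc ⟩
  t * c * q       ≡⟨ *-assoc t c q ⟩
  t * (c * q)     <⟨ *-monoʳ-< t {{m*n≢0⇒n≢0 ν}} cq<n ⟩
  t * n           ≤⟨ tn≤s ⟩
  s               ≤⟨ s≤νt ⟩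
  ν * t           ∎
  where
  open ≤-Reasoning
  deficit≤tc : ν * t ∸ s ≤ t * c
  deficit≤tc = m≤n+o⇒m∸n≤o (ν * t) s (begin
    ν * t         ≡⟨ *-comm ν t ⟩
    t * ν         ≤⟨ *-monoʳ-≤ t ν≤c+n ⟩
    t * (c + n)   ≡⟨ *-distribˡ-+ t c n ⟩
    t * c + t * n ≤⟨ +-monoʳ-≤ (t * c) tn≤s ⟩
    t * c + s     ≡⟨ +-comm (t * c) s ⟩
    s + t * c     ∎)

∣ratio-1∣≃ : ∀ {a d} → a ≤ suc d → toℚᵘ ∣ ratio a (suc d) - 1ℚ ∣ ≃ mkℚᵘ (+ (suc d ∸ a)) d
∣ratio-1∣≃ {a} {d} a≤1+d = begin
  toℚᵘ ∣ ratio a (suc d) - 1ℚ ∣                  ≈⟨ toℚᵘ-homo-∣-∣ (ratio a (suc d) - 1ℚ) ⟩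
  ℚᵘ.∣ toℚᵘ (ratio a (suc d) - 1ℚ) ∣              ≈⟨ ℚᵘ.∣-∣-cong (toℚᵘ-homo-+ (ratio a (suc d)) (- 1ℚ)) ⟩
  ℚᵘ.∣ toℚᵘ (ratio a (suc d)) ℚᵘ.+ toℚᵘ (- 1ℚ) ∣ ≈⟨ ℚᵘ.∣-∣-cong (ℚᵘ.+-congˡ _ (toℚᵘ-fromℚᵘ (mkℚᵘ (+ a) d))) ⟩
  ℚᵘ.∣ mkℚᵘ (+ a) d ℚᵘ.+ mkℚᵘ -[1+ 0 ] 0 ∣       ≡⟨ cong₂ mkℚᵘ (cong +_ ∣a-[1+d]∣≡1+d∸a) (*-identityʳ d) ⟩
  mkℚᵘ (+ (suc d ∸ a)) d                          ∎
  where
  open ℚᵘ.≃-Reasoning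
  ∣a-[1+d]∣≡1+d∸a : ℤ.∣ + a ℤ.* + 1 ℤ.+ -[1+ 0 ] ℤ.* + suc d ∣ ≡ suc d ∸ a
  ∣a-[1+d]∣≡1+d∸a = trans
    (cong ℤ.∣_∣ (trans (cong₂ ℤ._+_ (ℤ.*-identityʳ (+ a)) (ℤ.-1*i≡-i (+ suc d))) (ℤ.m-n≡m⊖n a (suc d))))
    (ℤ.∣⊖∣-≤ a≤1+d)

-- (d - a) / d < 1 / ↧ε ≤ ε; for d = 0 the hypothesis is void and ratio a 0 = 1ℚ by convention.
ratio-close : ∀ {a d} {ε : ℚ} → 0ℚ < ε → a ≤ d → (NonZero d → (d ∸ a) * ↧ₙ ε ℕ.< d) → ∣ ratio a d - 1ℚ ∣ < ε
ratio-close {d = zero} ε>0 _ _ = ε>0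
ratio-close {a} {suc d} {mkℚ +[1+ p ] q-1 _} _ a≤1+d close =
  toℚᵘ-cancel-< (ℚᵘ.<-respˡ-≃ (ℚᵘ.≃-sym (∣ratio-1∣≃ a≤1+d)) (ℚᵘ.*<* cross-multiplied))
  where
  cross-multiplied : + (suc d ∸ a) ℤ.* + suc q-1 ℤ.< + suc p ℤ.* + suc d
  cross-multiplied = subst₂ ℤ._<_ (ℤ.pos-* (suc d ∸ a) (suc q-1)) (ℤ.pos-* (suc p) (suc d))
    (ℤ.+<+ (<-≤-trans (close _) (m≤n*m (suc d) (suc p))))
ratio-close {ε = mkℚ (+ zero)  _ _} (*<* (ℤ.+<+ ()))
ratio-close {ε = mkℚ -[1+ _ ] _ _} (*<* ())

theorem12 : (c : ℕ) → (ε : ℚ) → 0ℚ < ε →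
    ∃[ N ] ((n : ℕ) → N ≤ n → ∣ 𝓘 (Ktilde c n) - 1ℚ ∣ < ε)
theorem12 c ε ε>0 = suc (c * ↧ₙ ε) , λ n cq<n →
  ratio-close ε>0 (T₁≤ν*T₀ (Ktilde c n)) λ nonZero →
    deficit-bound (T₀*n≤T₁ c n) (T₁≤ν*T₀ (Ktilde c n)) (ν≤c+n c n) cq<n {{nonZero}}
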